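{- Assume propositional extensionality. If there is an automorphism $f:\mathcal{U}\to\mathcal{U}$ of the universe with $f(\mathbf{1})=\mathbf{0}$, then double-negation elimination holds.
   Context: Work in intensional Martin-Löf type theory with $\Pi$-, $\Sigma$-, identity, finite types and natural numbers, and a universe $\mathcal{U}$ closed under these. $\neg X$ is $X\to\mathbf{0}$. A type is a proposition ($\mathrm{isProp}$) if any two elements are equal. Propositional extensionality: logically equivalent propositions are equal. DNE: $\prod_{P:\mathcal{U}}\mathrm{isProp}(P)\to\neg\neg P\to P$. An automorphism of $\mathcal{U}$ is a map $\mathcal{U}\to\mathcal{U}$ with a left and a right inverse. -}

module Defs where

open import Data.Empty using (⊥)
open import Data.Product using (Σ; _×_)
open import Relation.Nullary using (¬_)
open import Relation.Binary.PropositionalEquality using (_≡_)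

isProp : Set → Set
isProp X = (x y : X) → x ≡ y

PropExt : Set₁
PropExt = (P Q : Set) → isProp P → isProp Q → (P → Q) → (Q → P) → P ≡ Q

DNE : Set₁
DNE = (P : Set) → isProp P → ¬ ¬ P → P

hasLeftInverse : (Set → Set) → Set₁
hasLeftInverse f = Σ (Set → Set) (λ g → (X : Set) → g (f X) ≡ X)

hasRightInverse : (Set → Set) → Set₁
hasRightInverse f = Σ (Set → Set) (λ h → (X : Set) → f (h X) ≡ X)

isAutomorphism : (Set → Set) → Set₁
isAutomorphism f = hasLeftInverse f × hasRightInverse f

module Submission where

-- Let P be a proposition with ¬¬P. If f P had an element, then P would be
-- inhabited, so P = 𝟏 by propositional extensionality and f P = f 𝟏 = 𝟎,
-- which is absurd; hence f P is empty. So f P = 𝟎 = f 𝟏, and since f has a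
-- left inverse it is injective, giving P = 𝟏 and thus P.

open import Defs
open import Data.Empty using (⊥; ⊥-elim)
open import Data.Unit using (⊤; tt)
open import Data.Unit.Properties using (⊤-irrelevant)
open import Data.Product using (_,_)
open import Function using (id)
open import Relation.Nullary using (¬_)
open import Relation.Binary.PropositionalEquality
  using (_≡_; sym; trans; cong; subst)

transport : {X Y : Set} → X ≡ Y → X → Y
transport = subst id

empty-isProp : {X : Set} → ¬ X → isProp X
empty-isProp ¬x x = ⊥-elim (¬x x)

inhabited-prop≡⊤ : PropExt → {P : Set} → isProp P → P → P ≡ ⊤
inhabited-prop≡⊤ pe {P} isProp-P p = pe P ⊤ isProp-P ⊤-irrelevant (λ _ → tt) (λ _ → p)

empty≡⊥ : PropExt → {X : Set} → ¬ X → X ≡ ⊥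
empty≡⊥ pe {X} ¬x = pe X ⊥ (empty-isProp ¬x) (empty-isProp id) ¬x ⊥-elim

leftInverse⇒injective : {f : Set → Set} → hasLeftInverse f →
                        {X Y : Set} → f X ≡ f Y → X ≡ Y
leftInverse⇒injective (g , gf) {X} {Y} fX≡fY =
  trans (sym (gf X)) (trans (cong g fX≡fY) (gf Y))

image-of-¬¬prop-empty : PropExt → (f : Set → Set) → f ⊤ ≡ ⊥ →
                        {P : Set} → isProp P → ¬ ¬ P → ¬ f P
image-of-¬¬prop-empty pe f f⊤≡⊥ isProp-P ¬¬p y =
  ¬¬p λ p → transport (trans (cong f (inhabited-prop≡⊤ pe isProp-P p)) f⊤≡⊥) y

corollary3p8 : PropExt → (f : Set → Set) → isAutomorphism f → f ⊤ ≡ ⊥ → DNE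
corollary3p8 pe f (leftInv , _) f⊤≡⊥ P isProp-P ¬¬p = transport (sym P≡⊤) tt
  where
  fP≡f⊤ : f P ≡ f ⊤
  fP≡f⊤ = trans (empty≡⊥ pe (image-of-¬¬prop-empty pe f f⊤≡⊥ isProp-P ¬¬p)) (sym f⊤≡⊥)

  P≡⊤ : P ≡ ⊤
  P≡⊤ = leftInverse⇒injective leftInv fP≡f⊤
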